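{- Let $d$ be a fixed constant. There exists a constant $C_2 > 0$ (depending only on $d$) such that the following holds. Let $T=(V,E,r)$ be a rooted tree of degree $d$, let $K = C_2\log|V|$, and let $X$ be a sample of $K$ elements drawn independently and uniformly at random from $V$. Then for every vertex $s\in V$: (i) if $count(s,V) \ge \frac{|V|}{d}$, then $\Pr\left[count(s,X) \ge \frac{K}{d+1}\right] \ge 1-\frac{1}{|V|^2}$; (ii) if $count(s,V) \le |V|\frac{d-1}{d}$, then $\Pr\left[count(s,X) \le K\frac{d}{d+1}\right] \ge 1-\frac{1}{|V|^2}$; (iii) if $count(s,V) < \frac{|V|}{d+2}$, then $\Pr\left[count(s,X) < \frac{K}{d+1}\right] \ge 1-\frac{1}{|V|^2}$; (iv) if $count(s,V) > |V|\frac{d+1}{d+2}$, then $\Pr\left[count(s,X) > K\frac{d}{d+1}\right] \ge 1-\frac{1}{|V|^2}$.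
   Context: A rooted tree $T=(V,E,r)$ is an arborescence with all edges directed away from the root $r$; its degree is the maximum over vertices of in-degree plus out-degree. $path(u,v)=1$ if there is a directed path from $u$ to $v$ in $T$ and $0$ otherwise. For $u\in V$ and a (multi)set $W$ of vertices, $count(u,W)=\sum_{v\in W} path(u,v)$, the number of descendants of $u$ in $W$ (counted with multiplicity). -}

module Defs where

open import Data.Nat using (ℕ; zero; suc; _+_; _*_; _⊔_; _≤_; _<_; _≤?_; _<?_; _^_)
open import Data.Fin using (Fin; _≟_)
open import Data.Fin.Base using ()
open import Data.List using (List; []; _∷_; map; concatMap; length; filter; foldr; upTo; allFin)
open import Data.Nat.ListAction using (sum)
open import Data.List.Relation.Unary.Any using (any?)
open import Data.Vec using (Vec; []; _∷_; toList)
open import Data.Maybe using (Maybe; just; nothing; _>>=_; Is-just)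
open import Data.Maybe.Properties using (≡-dec)
open import Data.Product using (Σ; ∃; _,_)
open import Relation.Nullary using (¬_; does)
open import Relation.Binary.PropositionalEquality using (_≡_; _≢_)
open import Data.Bool using (Bool; if_then_else_)
import Data.Bool

-- A rooted tree on the vertex set Fin n, given by its parent function:
-- every edge is directed from parent w to child v (parent v ≡ just w).
-- iter k v = the k-th ancestor of v (if it exists); iter 0 v = just v.
iter : {n : ℕ} → (Fin n → Maybe (Fin n)) → ℕ → Fin n → Maybe (Fin n)
iter par zero v = just v
iter par (suc k) v = iter par k v >>= par

record RootedTree (n : ℕ) : Set where
  field
    parent : Fin n → Maybe (Fin n)
    root : Fin n
    root-parentless : parent root ≡ nothing
    nonroot-parent : ∀ v → v ≢ root → ¬ (parent v ≡ nothing)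
    reachable : ∀ v → ∃ λ k → iter parent k v ≡ just root

open RootedTree public

-- in-degree (0 or 1) plus out-degree (number of children)
deg : {n : ℕ} → RootedTree n → Fin n → ℕ
deg {n} T v =
  (if does (≡-dec _≟_ (parent T v) nothing) then 0 else 1)
  + length (filter (λ w → ≡-dec _≟_ (parent T w) (just v)) (allFin n))

degree : {n : ℕ} → RootedTree n → ℕ
degree {n} T = foldr _⊔_ 0 (map (deg T) (allFin n))

-- path T u v = 1 if there is a directed path (of length ≥ 0) from u to v, else 0.
-- A directed path in a tree on n vertices has length < n, so searching
-- k ∈ {0,…,n-1} for "u is the k-th ancestor of v" is exact.
path : {n : ℕ} → RootedTree n → Fin n → Fin n → ℕ
path {n} T u v =
  if does (any? (λ k → ≡-dec _≟_ (iter (parent T) k v) (just u)) (upTo n)) then 1 else 0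

count : {n : ℕ} → RootedTree n → Fin n → List (Fin n) → ℕ
count T u W = sum (map (path T u) W)

-- all samples of K elements of Fin n (ordered, with repetition): the n^K
-- equally likely outcomes of K independent uniform draws
samples : (n K : ℕ) → List (Vec (Fin n) K)
samples n zero = [] ∷ []
samples n (suc K) = concatMap (λ i → map (i ∷_) (samples n K)) (allFin n)

countSat : {n : ℕ} → (K : ℕ) → (Vec (Fin n) K → Bool) → ℕ
countSat {n} K P = length (filter (λ X → Data.Bool._≟_ (P X) Data.Bool.true) (samples n K))

-- "Pr[P] ≥ 1 - 1/n²" over uniform X ∈ (Fin n)^K, multiplied out:
-- #{X | P X} * n² ≥ (n² - 1) * n^K
HighProb : (n K : ℕ) → (Vec (Fin n) K → Bool) → Set
HighProb n K P = n ^ 2 * n ^ K ≤ countSat {n} K P * n ^ 2 + n ^ K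

module Submission where

-- Each of the four claims is a Chernoff tail bound for a 0/1 indicator f on
-- the vertices (f = "descendant of s" or its complement) whose density a/n
-- is at most r/(r+s), against a threshold θ/(θ+φ) with r·φ < θ·s.  The
-- proof is an exponential-moment argument carried out entirely in ℕ:
--   * give every sample X the weight ∏ᵢ wᵢ with w = (M+1)^(θ+φ) on f-hits
--     and M^(θ+φ) on misses; the total weight of all nᴷ samples is
--     (Σ_v w v)ᴷ, while every failing sample weighs at least
--     (M+1)^(θK)·M^(φK) (exchange), so Markov's inequality bounds the
--     failures: #bad·tiltᴷ ≤ nᴷ·momentᴷ  (chernoff);
--   * for M = base r θ φ the two-sided Bernoulli estimates give
--     moment < tilt (gap), and a Bernoulli amplification shows
--     n²·momentᴷ ≤ tiltᴷ once C ≥ 3·moment and n ≤ 2^⌈log₂ n⌉ (amplify);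
--   * together #bad·n² ≤ nᴷ, which is exactly HighProb (tail-bound).

open import Defs
open import Data.Nat
open import Data.Nat.Properties
open import Data.Nat.Tactic.RingSolver using (solve-∀)
open import Data.Nat.Induction using (<-rec)
open import Data.Nat.Logarithm using (⌈log₂_⌉; ⌈log₂⌉-mono-≤; ⌈log₂⌈n/2⌉⌉≡⌈log₂n⌉∸1)
open import Data.Nat.ListAction using (sum; product)
open import Data.Nat.ListAction.Properties using (sum-++)
open import Data.Fin using (Fin; zero; suc)
open import Data.List using (List; []; _∷_; _++_; map; concatMap; length; filter; allFin)
open import Data.List.Properties using (map-++; map-∘; map-cong; length-tabulate)
open import Data.Vec using (Vec; _∷_; toList)
open import Data.Vec.Properties using (length-toList)
open import Data.Bool using (Bool; true; false; if_then_else_)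
import Data.Bool
open import Data.Product using (Σ; _×_; _,_)
open import Data.Empty using (⊥-elim)
open import Relation.Nullary using (Dec; no; ¬_; does; contradiction)
open import Relation.Binary.PropositionalEquality
open import Algebra.Properties.CommutativeSemigroup +-commutativeSemigroup using (interchange)
open import Algebra.Properties.CommutativeSemigroup *-commutativeSemigroup using (x∙yz≈y∙xz)

[m*n]^k≡m^k*n^k : ∀ m n k → (m * n) ^ k ≡ m ^ k * n ^ k
[m*n]^k≡m^k*n^k m n zero = refl
[m*n]^k≡m^k*n^k m n (suc k) rewrite [m*n]^k≡m^k*n^k m n k =
  [m*n]*[o*p]≡[m*o]*[n*p] m n (m ^ k) (n ^ k)

-- Bernoulli's inequality (1 + 1/M)ᵏ ≥ 1 + k/M, multiplied out; it drives both
-- the gap between moment and tilt and the final amplification.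
bernoulli : ∀ M k → M ^ k * (M + k) ≤ M * suc M ^ k
bernoulli M zero = ≤-reflexive (base-case M)
  where
  base-case : ∀ M → 1 * (M + 0) ≡ M * 1
  base-case = solve-∀
bernoulli M (suc k) = begin
  M * M ^ k * (M + suc k)                 ≡⟨ split M (M ^ k) k ⟩
  M * (M ^ k * (M + k)) + M ^ k * M
    ≤⟨ +-monoʳ-≤ (M * (M ^ k * (M + k))) (*-monoʳ-≤ (M ^ k) (m≤m+n M k)) ⟩
  M * (M ^ k * (M + k)) + M ^ k * (M + k) ≡⟨ +-comm (M * (M ^ k * (M + k))) _ ⟩
  suc M * (M ^ k * (M + k))               ≤⟨ *-monoʳ-≤ (suc M) (bernoulli M k) ⟩
  suc M * (M * suc M ^ k)                 ≡⟨ x∙yz≈y∙xz (suc M) M (suc M ^ k) ⟩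
  M * (suc M * suc M ^ k)                 ∎
  where
  open ≤-Reasoning
  split : ∀ M x k → M * x * (M + suc k) ≡ M * (x * (M + k)) + x * M
  split = solve-∀

bernoulli-upper : ∀ M k → k ≤ M → M * M * suc M ^ k ≤ M ^ k * (M * M + k * M + k * k)
bernoulli-upper M zero _ = ≤-reflexive (base-case M)
  where
  base-case : ∀ M → M * M * 1 ≡ 1 * (M * M + 0 * M + 0 * 0)
  base-case = solve-∀
bernoulli-upper M (suc k) k<M = begin
  M * M * (suc M * suc M ^ k)                     ≡⟨ shift M (suc M ^ k) ⟩
  suc M * (M * M * suc M ^ k)                     ≤⟨ *-monoʳ-≤ (suc M) (bernoulli-upper M k (<⇒≤ k<M)) ⟩
  suc M * (M ^ k * (M * M + k * M + k * k))       ≡⟨ expand M (M ^ k) k ⟩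
  M ^ k * (M * M * M + suc k * M * M + (k * k + k) * M) + M ^ k * (k * k)
    ≤⟨ +-monoʳ-≤ (M ^ k * _) (*-monoʳ-≤ (M ^ k) k²≤[k+1]M) ⟩
  M ^ k * (M * M * M + suc k * M * M + (k * k + k) * M) + M ^ k * (suc k * M)
    ≡⟨ collect M (M ^ k) k ⟩
  M * M ^ k * (M * M + suc k * M + suc k * suc k) ∎
  where
  open ≤-Reasoning
  shift : ∀ M x → M * M * (suc M * x) ≡ suc M * (M * M * x)
  shift = solve-∀
  expand : ∀ M z k → suc M * (z * (M * M + k * M + k * k))
                   ≡ z * (M * M * M + suc k * M * M + (k * k + k) * M) + z * (k * k)
  expand = solve-∀
  collect : ∀ M z k → z * (M * M * M + suc k * M * M + (k * k + k) * M) + z * (suc k * M)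
                    ≡ M * z * (M * M + suc k * M + suc k * suc k)
  collect = solve-∀
  k²≤[k+1]M : k * k ≤ suc k * M
  k²≤[k+1]M = *-mono-≤ (n≤1+n k) (<⇒≤ k<M)

-- Chernoff bookkeeping for a density r/(r+s) and a threshold θ/(θ+φ), with the
-- exponential parameter λ = (M+1)/M scaled to integers: moment/(r+s)M^(θ+φ)
-- is the per-draw moment E[λ^((θ+φ)·hit)] and tilt/(r+s)M^(θ+φ) is λ^θ.
moment : (r s θ φ M : ℕ) → ℕ
moment r s θ φ M = r * suc M ^ (θ + φ) + s * M ^ (θ + φ)

tilt : (r s θ φ M : ℕ) → ℕ
tilt r s θ φ M = (r + s) * (suc M ^ θ * M ^ φ)

tilt-power : ∀ r s θ φ M K → tilt r s θ φ M ^ K ≡ (r + s) ^ K * (suc M ^ (θ * K) * M ^ (φ * K))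
tilt-power r s θ φ M K = begin
  ((r + s) * (suc M ^ θ * M ^ φ)) ^ K           ≡⟨ [m*n]^k≡m^k*n^k (r + s) _ K ⟩
  (r + s) ^ K * (suc M ^ θ * M ^ φ) ^ K
    ≡⟨ cong ((r + s) ^ K *_) ([m*n]^k≡m^k*n^k (suc M ^ θ) (M ^ φ) K) ⟩
  (r + s) ^ K * ((suc M ^ θ) ^ K * (M ^ φ) ^ K)
    ≡⟨ cong ((r + s) ^ K *_) (cong₂ _*_ (^-*-assoc (suc M) θ K) (^-*-assoc M φ K)) ⟩
  (r + s) ^ K * (suc M ^ (θ * K) * M ^ (φ * K)) ∎
  where open ≡-Reasoning

-- A base M large enough that the moment is strictly below the tilt.
base : (r θ φ : ℕ) → ℕ
base r θ φ = suc (r * (θ + φ) * (θ + φ) + (θ + φ))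

-- Multiply by
-- M², bound (M+1)^(θ+φ) from above and (M+1)^θ from below by Bernoulli.
gap : ∀ r s θ φ → r * φ < θ * s →
  moment r s θ φ (base r θ φ) < tilt r s θ φ (base r θ φ)
gap r s θ φ rφ<θs = *-cancelˡ-< (M * M) _ _ (begin-strict
  M * M * (r * suc M ^ t + s * M ^ t)
    ≡⟨ cong (λ z → M * M * (r * suc M ^ t + s * z)) Mᵗ ⟩
  M * M * (r * suc M ^ t + s * Mᶿ)        ≡⟨ ring₁ M r s (suc M ^ t) Mᶿ ⟩
  r * (M * M * suc M ^ t) + s * M * M * Mᶿ
    ≤⟨ +-monoˡ-≤ _ (*-monoʳ-≤ r (bernoulli-upper M t t≤M)) ⟩
  r * (M ^ t * (M * M + t * M + t * t)) + s * M * M * Mᶿ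
    ≡⟨ cong (λ z → r * (z * (M * M + t * M + t * t)) + s * M * M * Mᶿ) Mᵗ ⟩
  r * (Mᶿ * (M * M + t * M + t * t)) + s * M * M * Mᶿ
    ≡⟨ ring₂ M r s θ φ Mᶿ ⟩
  Mᶿ * ((r + s) * M * M + r * θ * M + (r * φ * M + r * t * t))
    <⟨ *-monoʳ-< Mᶿ {{Mᶿ≢0}} (+-monoʳ-< _ key) ⟩
  Mᶿ * ((r + s) * M * M + r * θ * M + θ * s * M)
    ≡⟨ ring₃ M r s θ (M ^ θ) (M ^ φ) ⟩
  (r + s) * M * M ^ φ * (M ^ θ * (M + θ))
    ≤⟨ *-monoʳ-≤ ((r + s) * M * M ^ φ) (bernoulli M θ) ⟩
  (r + s) * M * M ^ φ * (M * suc M ^ θ)   ≡⟨ ring₄ M r s (M ^ φ) (suc M ^ θ) ⟩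
  M * M * ((r + s) * (suc M ^ θ * M ^ φ)) ∎)
  where
  open ≤-Reasoning
  t = θ + φ
  M = base r θ φ
  Mᶿ = M ^ θ * M ^ φ
  Mᵗ : M ^ t ≡ Mᶿ
  Mᵗ = ^-distribˡ-+-* M θ φ
  Mᶿ≢0 : NonZero Mᶿ
  Mᶿ≢0 = m*n≢0 _ _ {{m^n≢0 M θ}} {{m^n≢0 M φ}}
  t≤M : t ≤ M
  t≤M = m≤n⇒m≤1+n (m≤n+m t (r * t * t))
  key : r * φ * M + r * t * t < θ * s * M
  key = begin-strict
    r * φ * M + r * t * t <⟨ +-monoʳ-< (r * φ * M) (s≤s (m≤m+n (r * t * t) t)) ⟩
    r * φ * M + M         ≡⟨ +-comm (r * φ * M) M ⟩
    suc (r * φ) * M       ≤⟨ *-monoˡ-≤ M rφ<θs ⟩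
    θ * s * M             ∎
  ring₁ : ∀ M r s a b → M * M * (r * a + s * b) ≡ r * (M * M * a) + s * M * M * b
  ring₁ = solve-∀
  ring₂ : ∀ M r s θ φ x → r * (x * (M * M + (θ + φ) * M + (θ + φ) * (θ + φ))) + s * M * M * x
        ≡ x * ((r + s) * M * M + r * θ * M + (r * φ * M + r * (θ + φ) * (θ + φ)))
  ring₂ = solve-∀
  ring₃ : ∀ M r s θ x y → x * y * ((r + s) * M * M + r * θ * M + θ * s * M)
        ≡ (r + s) * M * y * (x * (M + θ))
  ring₃ = solve-∀
  ring₄ : ∀ M r s y z → (r + s) * M * y * (M * z) ≡ M * M * ((r + s) * (z * y))
  ring₄ = solve-∀

n≤2^⌈log₂n⌉ : ∀ n → n ≤ 2 ^ ⌈log₂ n ⌉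
n≤2^⌈log₂n⌉ = <-rec (λ n → n ≤ 2 ^ ⌈log₂ n ⌉) step
  where
  step : ∀ n → (∀ {m} → m < n → m ≤ 2 ^ ⌈log₂ m ⌉) → n ≤ 2 ^ ⌈log₂ n ⌉
  step zero          _  = z≤n
  step (suc zero)    _  = s≤s z≤n
  step n@(suc (suc k)) ih = begin
    n                               ≡⟨ sym (⌊n/2⌋+⌈n/2⌉≡n n) ⟩
    ⌊ n /2⌋ + ⌈ n /2⌉               ≤⟨ +-monoˡ-≤ ⌈ n /2⌉ (⌊n/2⌋≤⌈n/2⌉ n) ⟩
    ⌈ n /2⌉ + ⌈ n /2⌉               ≡⟨ cong (⌈ n /2⌉ +_) (sym (+-identityʳ ⌈ n /2⌉)) ⟩
    2 * ⌈ n /2⌉                     ≤⟨ *-monoʳ-≤ 2 (ih (⌈n/2⌉<n k)) ⟩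
    2 * 2 ^ ⌈log₂ ⌈ n /2⌉ ⌉         ≡⟨ cong (λ e → 2 * 2 ^ e) (⌈log₂⌈n/2⌉⌉≡⌈log₂n⌉∸1 n) ⟩
    2 ^ suc (⌈log₂ n ⌉ ∸ 1)
      ≡⟨ cong (2 ^_) (m+[n∸m]≡n (⌈log₂⌉-mono-≤ {2} {n} (s≤s (s≤s z≤n)))) ⟩
    2 ^ ⌈log₂ n ⌉                   ∎
    where open ≤-Reasoning

-- A ratio Q/P < 1 raised to a power C ≥ 3Q is at most 1/4, since
-- Qᶜ(Q + C) ≤ Q(Q+1)ᶜ (Bernoulli) and Q + C ≥ 4Q.
four-fold : ∀ Q P C → 0 < Q → Q < P → 3 * Q ≤ C → 4 * Q ^ C ≤ P ^ C
four-fold Q P C 0<Q Q<P 3Q≤C = *-cancelʳ-≤ (4 * Q ^ C) (P ^ C) Q {{>-nonZero 0<Q}} (begin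
  4 * Q ^ C * Q     ≡⟨ regroup Q (Q ^ C) ⟩
  Q ^ C * (Q + 3 * Q) ≤⟨ *-monoʳ-≤ (Q ^ C) (+-monoʳ-≤ Q 3Q≤C) ⟩
  Q ^ C * (Q + C)   ≤⟨ bernoulli Q C ⟩
  Q * suc Q ^ C     ≤⟨ *-monoʳ-≤ Q (^-monoˡ-≤ C Q<P) ⟩
  Q * P ^ C         ≡⟨ *-comm Q (P ^ C) ⟩
  P ^ C * Q         ∎)
  where
  open ≤-Reasoning
  regroup : ∀ Q x → 4 * x * Q ≡ x * (Q + 3 * Q)
  regroup = solve-∀

-- Hence C·L repetitions with C ≥ 3Q and n ≤ 2ᴸ beat the factor n² ≤ 4ᴸ.
amplify : ∀ n L C Q P → 0 < Q → Q < P → 3 * Q ≤ C → n ≤ 2 ^ L →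
  n ^ 2 * Q ^ (C * L) ≤ P ^ (C * L)
amplify n L C Q P 0<Q Q<P 3Q≤C n≤2^L = begin
  n ^ 2 * Q ^ (C * L)     ≤⟨ *-monoˡ-≤ (Q ^ (C * L)) n²≤4^L ⟩
  4 ^ L * Q ^ (C * L)     ≡⟨ cong (4 ^ L *_) (sym (^-*-assoc Q C L)) ⟩
  4 ^ L * (Q ^ C) ^ L     ≡⟨ sym ([m*n]^k≡m^k*n^k 4 (Q ^ C) L) ⟩
  (4 * Q ^ C) ^ L         ≤⟨ ^-monoˡ-≤ L (four-fold Q P C 0<Q Q<P 3Q≤C) ⟩
  (P ^ C) ^ L             ≡⟨ ^-*-assoc P C L ⟩
  P ^ (C * L)             ∎
  where
  open ≤-Reasoning
  n²≤4^L : n ^ 2 ≤ 4 ^ L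
  n²≤4^L = begin
    n ^ 2         ≤⟨ ^-monoˡ-≤ 2 n≤2^L ⟩
    (2 ^ L) ^ 2   ≡⟨ ^-*-assoc 2 L 2 ⟩
    2 ^ (L * 2)   ≡⟨ cong (2 ^_) (*-comm L 2) ⟩
    2 ^ (2 * L)   ≡⟨ sym (^-*-assoc 2 2 L) ⟩
    4 ^ L         ∎

exchange : ∀ {x y} u v u′ v′ → x ≤ y → u ≤ u′ → u + v ≡ u′ + v′ →
  y ^ u * x ^ v ≤ y ^ u′ * x ^ v′
exchange {x} {y} u v u′ v′ x≤y u≤u′ eq with m≤n⇒∃[o]m+o≡n u≤u′
... | e , refl = begin
  y ^ u * x ^ v            ≡⟨ cong (λ w → y ^ u * x ^ w) v≡e+v′ ⟩
  y ^ u * x ^ (e + v′)     ≡⟨ cong (y ^ u *_) (^-distribˡ-+-* x e v′) ⟩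
  y ^ u * (x ^ e * x ^ v′) ≤⟨ *-monoʳ-≤ (y ^ u) (*-monoˡ-≤ (x ^ v′) (^-monoˡ-≤ e x≤y)) ⟩
  y ^ u * (y ^ e * x ^ v′) ≡⟨ sym (*-assoc (y ^ u) _ _) ⟩
  y ^ u * y ^ e * x ^ v′   ≡⟨ cong (_* x ^ v′) (sym (^-distribˡ-+-* y u e)) ⟩
  y ^ (u + e) * x ^ v′     ∎
  where
  open ≤-Reasoning
  v≡e+v′ : v ≡ e + v′
  v≡e+v′ = +-cancelˡ-≡ u v (e + v′) (trans eq (+-assoc u e v′))

mixing : ∀ a a′ r s α β → a * s ≤ a′ * r → β ≤ α →
  (r + s) * (a * α + a′ * β) ≤ (a + a′) * (r * α + s * β)
mixing a a′ r s α β as≤a′r β≤α with m≤n⇒∃[o]m+o≡n β≤α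
... | δ , refl = +-cancelʳ-≤ (a * s * δ) _ _ (begin
  (r + s) * (a * (β + δ) + a′ * β) + a * s * δ ≤⟨ +-monoʳ-≤ _ (*-monoˡ-≤ δ as≤a′r) ⟩
  (r + s) * (a * (β + δ) + a′ * β) + a′ * r * δ ≡⟨ identity a a′ r s β δ ⟩
  (a + a′) * (r * (β + δ) + s * β) + a * s * δ ∎)
  where
  open ≤-Reasoning
  identity : ∀ a a′ r s β δ → (r + s) * (a * (β + δ) + a′ * β) + a′ * r * δ
           ≡ (a + a′) * (r * (β + δ) + s * β) + a * s * δ
  identity = solve-∀

moment-positive : ∀ r s θ φ m → 0 < s → 0 < moment r s θ φ (suc m)
moment-positive r s θ φ m 0<s = ≤-trans (*-mono-≤ 0<s (m^n>0 (suc m) (θ + φ))) (m≤n+m _ (r * _))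

factor-positive : ∀ {k} θ s → k < θ * s → 0 < s
factor-positive {k} θ zero k<θ0 = contradiction (subst (k <_) (*-zeroʳ θ) k<θ0) n≮0
factor-positive θ (suc s) _ = z<s

sum-map-*ˡ : ∀ {A : Set} c (g : A → ℕ) xs → sum (map (λ x → c * g x) xs) ≡ c * sum (map g xs)
sum-map-*ˡ c g [] = sym (*-zeroʳ c)
sum-map-*ˡ c g (x ∷ xs) = trans (cong (c * g x +_) (sum-map-*ˡ c g xs)) (sym (*-distribˡ-+ c (g x) _))

sum-map-*ʳ : ∀ {A : Set} c (g : A → ℕ) xs → sum (map (λ x → g x * c) xs) ≡ sum (map g xs) * c
sum-map-*ʳ c g [] = refl
sum-map-*ʳ c g (x ∷ xs) = trans (cong (g x * c +_) (sum-map-*ʳ c g xs)) (sym (*-distribʳ-+ c (g x) _))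

sum-map-+ : ∀ {A : Set} (g h : A → ℕ) xs →
  sum (map (λ x → g x + h x) xs) ≡ sum (map g xs) + sum (map h xs)
sum-map-+ g h [] = refl
sum-map-+ g h (x ∷ xs) = trans (cong (g x + h x +_) (sum-map-+ g h xs)) (interchange (g x) (h x) _ _)

sum-map-concatMap : ∀ {A B : Set} (g : B → ℕ) (h : A → List B) xs →
  sum (map g (concatMap h xs)) ≡ sum (map (λ x → sum (map g (h x))) xs)
sum-map-concatMap g h [] = refl
sum-map-concatMap g h (x ∷ xs) = begin
  sum (map g (h x ++ concatMap h xs))              ≡⟨ cong sum (map-++ g (h x) (concatMap h xs)) ⟩
  sum (map g (h x) ++ map g (concatMap h xs))      ≡⟨ sum-++ (map g (h x)) _ ⟩
  sum (map g (h x)) + sum (map g (concatMap h xs)) ≡⟨ cong (sum (map g (h x)) +_) (sum-map-concatMap g h xs) ⟩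
  sum (map g (h x)) + sum (map (λ y → sum (map g (h y))) xs) ∎
  where open ≡-Reasoning

weight : ∀ {n K} → (Fin n → ℕ) → Vec (Fin n) K → ℕ
weight g X = product (map g (toList X))

-- Independence of the draws: the total product weight over all nᴷ samples
-- is the K-th power of the total weight of one draw.
sum-weight : ∀ n K (g : Fin n → ℕ) →
  sum (map (weight g) (samples n K)) ≡ sum (map g (allFin n)) ^ K
sum-weight n zero g = refl
sum-weight n (suc K) g = begin
  sum (map (weight g) (concatMap extend (allFin n)))
    ≡⟨ sum-map-concatMap (weight g) extend (allFin n) ⟩
  sum (map (λ i → sum (map (weight g) (extend i))) (allFin n))
    ≡⟨ cong sum (map-cong first-coordinate (allFin n)) ⟩
  sum (map (λ i → g i * sum (map (weight g) (samples n K))) (allFin n))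
    ≡⟨ sum-map-*ʳ _ g (allFin n) ⟩
  sum (map g (allFin n)) * sum (map (weight g) (samples n K))
    ≡⟨ cong (sum (map g (allFin n)) *_) (sum-weight n K g) ⟩
  sum (map g (allFin n)) ^ suc K ∎
  where
  open ≡-Reasoning
  extend : Fin n → List (Vec (Fin n) (suc K))
  extend i = map (i ∷_) (samples n K)
  first-coordinate : ∀ i → sum (map (weight g) (extend i)) ≡ g i * sum (map (weight g) (samples n K))
  first-coordinate i = trans (cong sum (sym (map-∘ (samples n K)))) (sum-map-*ˡ (g i) (weight g) (samples n K))

length-samples : ∀ n K → length (samples n K) ≡ n ^ K
length-samples n K = begin
  length (samples n K)                          ≡⟨ sym (sum-ones (samples n K)) ⟩
  sum (map (λ _ → 1) (samples n K))
    ≡⟨ cong sum (map-cong (λ X → sym (product-ones (toList X))) (samples n K)) ⟩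
  sum (map (weight (λ _ → 1)) (samples n K))    ≡⟨ sum-weight n K (λ _ → 1) ⟩
  sum (map (λ _ → 1) (allFin n)) ^ K
    ≡⟨ cong (_^ K) (trans (sum-ones (allFin n)) (length-tabulate (λ i → i))) ⟩
  n ^ K ∎
  where
  open ≡-Reasoning
  sum-ones : ∀ {A : Set} (xs : List A) → sum (map (λ _ → 1) xs) ≡ length xs
  sum-ones [] = refl
  sum-ones (_ ∷ xs) = cong suc (sum-ones xs)
  product-ones : ∀ {A : Set} (xs : List A) → product (map (λ _ → 1) xs) ≡ 1
  product-ones [] = refl
  product-ones (_ ∷ xs) = trans (+-identityʳ _) (product-ones xs)

failures : ∀ {A : Set} → (A → Bool) → List A → ℕ
failures P xs = length (filter (λ x → Data.Bool._≟_ (P x) false) xs)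

successes+failures : ∀ {A : Set} (P : A → Bool) xs →
  length (filter (λ x → Data.Bool._≟_ (P x) true) xs) + failures P xs ≡ length xs
successes+failures P [] = refl
successes+failures P (x ∷ xs) with P x
... | true  = cong suc (successes+failures P xs)
... | false = trans (+-suc _ _) (cong suc (successes+failures P xs))

markov : ∀ {A : Set} (P : A → Bool) (w : A → ℕ) B → (∀ x → P x ≡ false → B ≤ w x) →
  ∀ xs → failures P xs * B ≤ sum (map w xs)
markov P w B heavy [] = z≤n
markov P w B heavy (x ∷ xs) with P x in eq
... | true  = ≤-trans (markov P w B heavy xs) (m≤n+m _ (w x))
... | false = +-mono-≤ (heavy x eq) (markov P w B heavy xs)

high-probability : ∀ n K (P : Vec (Fin n) K → Bool) →
  failures P (samples n K) * n ^ 2 ≤ n ^ K → HighProb n K P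
high-probability n K P few = begin
  n ^ 2 * n ^ K
    ≡⟨ cong (n ^ 2 *_) (sym (trans (successes+failures P (samples n K)) (length-samples n K))) ⟩
  n ^ 2 * (good + bad)        ≡⟨ *-distribˡ-+ (n ^ 2) good bad ⟩
  n ^ 2 * good + n ^ 2 * bad  ≡⟨ cong₂ _+_ (*-comm (n ^ 2) good) (*-comm (n ^ 2) bad) ⟩
  good * n ^ 2 + bad * n ^ 2  ≤⟨ +-monoʳ-≤ (good * n ^ 2) few ⟩
  good * n ^ 2 + n ^ K        ∎
  where
  open ≤-Reasoning
  good = countSat {n} K P
  bad = failures P (samples n K)

module _ {A : Set} (f f′ : A → ℕ) (complementary : ∀ v → f v + f′ v ≡ 1) where

  hits+misses : ∀ xs → sum (map f xs) + sum (map f′ xs) ≡ length xs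
  hits+misses [] = refl
  hits+misses (x ∷ xs) = begin
    f x + sum (map f xs) + (f′ x + sum (map f′ xs)) ≡⟨ interchange (f x) _ (f′ x) _ ⟩
    f x + f′ x + (sum (map f xs) + sum (map f′ xs)) ≡⟨ cong₂ _+_ (complementary x) (hits+misses xs) ⟩
    suc (length xs) ∎
    where open ≡-Reasoning

  product-indicator : ∀ α β xs →
    product (map (λ v → f v * α + f′ v * β) xs) ≡ α ^ sum (map f xs) * β ^ sum (map f′ xs)
  product-indicator α β [] = refl
  product-indicator α β (x ∷ xs) with f x | f′ x | complementary x
  ... | 1 | 0 | refl rewrite product-indicator α β xs = hit α β (α ^ sum (map f xs)) (β ^ sum (map f′ xs))
    where
    hit : ∀ α β p q → (1 * α + 0 * β) * (p * q) ≡ α * p * q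
    hit = solve-∀
  ... | 0 | 1 | refl rewrite product-indicator α β xs = miss α β (α ^ sum (map f xs)) (β ^ sum (map f′ xs))
    where
    miss : ∀ α β p q → (0 * α + 1 * β) * (p * q) ≡ p * (β * q)
    miss = solve-∀

module _ {n : ℕ} (f f′ : Fin n → ℕ) (complementary : ∀ v → f v + f′ v ≡ 1) where

  mass : sum (map f (allFin n)) + sum (map f′ (allFin n)) ≡ n
  mass = trans (hits+misses f f′ complementary (allFin n)) (length-tabulate (λ i → i))

  sample-split : ∀ {K} (X : Vec (Fin n) K) → sum (map f (toList X)) + sum (map f′ (toList X)) ≡ K
  sample-split X = trans (hits+misses f f′ complementary (toList X)) (length-toList X)

  tilted : ℕ → ℕ → Fin n → ℕ
  tilted t M v = f v * suc M ^ t + f′ v * M ^ t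

  heavy : ∀ {K} θ φ M (X : Vec (Fin n) K) → θ * K ≤ (θ + φ) * sum (map f (toList X)) →
    suc M ^ (θ * K) * M ^ (φ * K) ≤ weight (tilted (θ + φ) M) X
  heavy {K} θ φ M X frequent = begin
    suc M ^ (θ * K) * M ^ (φ * K)   ≤⟨ exchange (θ * K) (φ * K) (t * c) (t * c′) (n≤1+n M) frequent split ⟩
    suc M ^ (t * c) * M ^ (t * c′)  ≡⟨ cong₂ _*_ (sym (^-*-assoc (suc M) t c)) (sym (^-*-assoc M t c′)) ⟩
    (suc M ^ t) ^ c * (M ^ t) ^ c′
      ≡⟨ sym (product-indicator f f′ complementary (suc M ^ t) (M ^ t) (toList X)) ⟩
    weight (tilted t M) X           ∎
    where
    open ≤-Reasoning
    t = θ + φ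
    c = sum (map f (toList X))
    c′ = sum (map f′ (toList X))
    split : θ * K + φ * K ≡ t * c + t * c′
    split = begin-equality
      θ * K + φ * K   ≡⟨ sym (*-distribʳ-+ K θ φ) ⟩
      t * K           ≡⟨ cong (t *_) (sym (sample-split X)) ⟩
      t * (c + c′)    ≡⟨ *-distribˡ-+ t c c′ ⟩
      t * c + t * c′  ∎

  chernoff : ∀ K (r s θ φ M : ℕ) (P : Vec (Fin n) K → Bool) →
    sum (map f (allFin n)) * s ≤ sum (map f′ (allFin n)) * r →
    (∀ X → P X ≡ false → θ * K ≤ (θ + φ) * sum (map f (toList X))) →
    failures P (samples n K) * tilt r s θ φ M ^ K ≤ n ^ K * moment r s θ φ M ^ K
  chernoff K r s θ φ M P density tail = begin
    bad * tilt r s θ φ M ^ K                 ≡⟨ cong (bad *_) (tilt-power r s θ φ M K) ⟩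
    bad * ((r + s) ^ K * B)                  ≡⟨ x∙yz≈y∙xz bad ((r + s) ^ K) B ⟩
    (r + s) ^ K * (bad * B)                  ≤⟨ *-monoʳ-≤ ((r + s) ^ K) markov-bound ⟩
    (r + s) ^ K * (a * α + a′ * β) ^ K       ≡⟨ sym ([m*n]^k≡m^k*n^k (r + s) _ K) ⟩
    ((r + s) * (a * α + a′ * β)) ^ K
      ≤⟨ ^-monoˡ-≤ K (mixing a a′ r s α β density (^-monoˡ-≤ t (n≤1+n M))) ⟩
    ((a + a′) * moment r s θ φ M) ^ K        ≡⟨ cong (λ m → (m * moment r s θ φ M) ^ K) mass ⟩
    (n * moment r s θ φ M) ^ K               ≡⟨ [m*n]^k≡m^k*n^k n _ K ⟩
    n ^ K * moment r s θ φ M ^ K             ∎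
    where
    open ≤-Reasoning
    a = sum (map f (allFin n))
    a′ = sum (map f′ (allFin n))
    bad = failures P (samples n K)
    t = θ + φ
    α = suc M ^ t
    β = M ^ t
    w : Fin n → ℕ
    w = tilted t M
    B = suc M ^ (θ * K) * M ^ (φ * K)
    total : sum (map w (allFin n)) ≡ a * α + a′ * β
    total = trans (sum-map-+ (λ v → f v * α) (λ v → f′ v * β) (allFin n))
                  (cong₂ _+_ (sum-map-*ʳ α f (allFin n)) (sum-map-*ʳ β f′ (allFin n)))
    -- failing samples are heavy, so Markov bounds their number
    markov-bound : bad * B ≤ (a * α + a′ * β) ^ K
    markov-bound = begin
      bad * B
        ≤⟨ markov P (weight w) B (λ X fails → heavy θ φ M X (tail X fails)) (samples n K) ⟩
      sum (map (weight w) (samples n K)) ≡⟨ sum-weight n K w ⟩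
      sum (map w (allFin n)) ^ K         ≡⟨ cong (_^ K) total ⟩
      (a * α + a′ * β) ^ K               ∎

  tail-bound : ∀ r s θ φ C (P : Vec (Fin n) (C * ⌈log₂ n ⌉) → Bool) →
    r * φ < θ * s → 3 * moment r s θ φ (base r θ φ) ≤ C →
    sum (map f (allFin n)) * s ≤ sum (map f′ (allFin n)) * r →
    (∀ X → P X ≡ false → θ * (C * ⌈log₂ n ⌉) ≤ (θ + φ) * sum (map f (toList X))) →
    HighProb n (C * ⌈log₂ n ⌉) P
  tail-bound r s θ φ C P rφ<θs 3Q≤C density tail =
    high-probability n K P (*-cancelʳ-≤ (bad * n ^ 2) (n ^ K) (Q ^ K) {{Qᴷ≢0}} (begin
      bad * n ^ 2 * Q ^ K   ≡⟨ *-assoc bad (n ^ 2) (Q ^ K) ⟩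
      bad * (n ^ 2 * Q ^ K)
        ≤⟨ *-monoʳ-≤ bad (amplify n L C Q T 0<Q (gap r s θ φ rφ<θs) 3Q≤C (n≤2^⌈log₂n⌉ n)) ⟩
      bad * T ^ K           ≤⟨ chernoff K r s θ φ M P density tail ⟩
      n ^ K * Q ^ K         ∎))
    where
    open ≤-Reasoning
    L = ⌈log₂ n ⌉
    K = C * L
    M = base r θ φ
    Q = moment r s θ φ M
    T = tilt r s θ φ M
    bad = failures P (samples n K)
    0<Q : 0 < Q
    0<Q = moment-positive r s θ φ _ (factor-positive θ s rφ<θs)
    Qᴷ≢0 : NonZero (Q ^ K)
    Qᴷ≢0 = m^n≢0 Q K {{>-nonZero 0<Q}}

rejected : ∀ {A : Set} (a? : Dec A) → does a? ≡ false → ¬ A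
rejected (no ¬a) _ = ¬a

complement-count : ∀ c c′ {K} u x → c + c′ ≡ K → c * u + x ≤ u * K → x ≤ u * c′
complement-count c c′ {K} u x c+c′≡K bound = +-cancelˡ-≤ (c * u) x (u * c′) (begin
  c * u + x         ≤⟨ bound ⟩
  u * K             ≡⟨ cong (u *_) (sym c+c′≡K) ⟩
  u * (c + c′)      ≡⟨ *-distribˡ-+ u c c′ ⟩
  u * c + u * c′    ≡⟨ cong (_+ u * c′) (*-comm u c) ⟩
  c * u + u * c′    ∎)
  where open ≤-Reasoning

-- The four hypotheses of the theorem, written (with n = a + a′) as density
-- bounds of the form a·s ≤ a′·r for the indicator or its complement.
density-large : ∀ a a′ r → a + a′ ≤ a * suc r → a′ * 1 ≤ a * r
density-large a a′ r h = +-cancelʳ-≤ a (a′ * 1) (a * r) (begin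
  a′ * 1 + a ≡⟨ e₁ a a′ ⟩ a + a′ ≤⟨ h ⟩ a * suc r ≡⟨ e₂ a r ⟩ a * r + a ∎)
  where
  open ≤-Reasoning
  e₁ : ∀ a a′ → a′ * 1 + a ≡ a + a′
  e₁ = solve-∀
  e₂ : ∀ a r → a * suc r ≡ a * r + a
  e₂ = solve-∀

density-not-large : ∀ a a′ r → a * suc r + (a + a′) ≤ (a + a′) * suc r → a * 1 ≤ a′ * r
density-not-large a a′ r h = +-cancelˡ-≤ (a * suc r + a′) (a * 1) (a′ * r) (begin
  a * suc r + a′ + a * 1  ≡⟨ e₁ a a′ r ⟩
  a * suc r + (a + a′)    ≤⟨ h ⟩
  (a + a′) * suc r        ≡⟨ e₂ a a′ r ⟩
  a * suc r + a′ + a′ * r ∎)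
  where
  open ≤-Reasoning
  e₁ : ∀ a a′ r → a * suc r + a′ + a * 1 ≡ a * suc r + (a + a′)
  e₁ = solve-∀
  e₂ : ∀ a a′ r → (a + a′) * suc r ≡ a * suc r + a′ + a′ * r
  e₂ = solve-∀

density-small : ∀ a a′ d → a * suc (suc d) < a + a′ → a * suc d ≤ a′ * 1
density-small a a′ d h = +-cancelˡ-≤ a (a * suc d) (a′ * 1) (begin
  a + a * suc d   ≡⟨ e₁ a d ⟩
  a * suc (suc d) ≤⟨ <⇒≤ h ⟩
  a + a′          ≡⟨ cong (a +_) (sym (*-identityʳ a′)) ⟩
  a + a′ * 1      ∎)
  where
  open ≤-Reasoning
  e₁ : ∀ a d → a + a * suc d ≡ a * suc (suc d)
  e₁ = solve-∀

density-not-small : ∀ a a′ d → (a + a′) * suc d < a * suc (suc d) → a′ * suc d ≤ a * 1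
density-not-small a a′ d h = <⇒≤ (+-cancelˡ-< (a * suc d) (a′ * suc d) (a * 1) (begin-strict
  a * suc d + a′ * suc d ≡⟨ sym (*-distribʳ-+ (suc d) a a′) ⟩
  (a + a′) * suc d       <⟨ h ⟩
  a * suc (suc d)        ≡⟨ e₁ a d ⟩
  a * suc d + a * 1      ∎))
  where
  open ≤-Reasoning
  e₁ : ∀ a d → a * suc (suc d) ≡ a * suc d + a * 1
  e₁ = solve-∀

-- Moments of the two tail problems of the theorem: density (d-1)/d against
-- threshold d/(d+1) for d = r+1 (claims (i),(ii)), and density 1/(d+2)
-- against threshold 1/(d+1) (claims (iii),(iv)).
moment-large : ℕ → ℕ
moment-large r = moment r 1 (suc r) 1 (base r (suc r) 1)

moment-small : ℕ → ℕ
moment-small d = moment 1 (suc d) 1 d (base 1 1 d)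

budget : ℕ → ℕ
budget d = 3 * (moment-large (d ∸ 1) + moment-small d)

budget-large : ∀ r → 3 * moment-large r ≤ budget (suc r)
budget-large r = *-monoʳ-≤ 3 (m≤m+n (moment-large r) (moment-small (suc r)))

budget-small : ∀ d → 3 * moment-small d ≤ budget d
budget-small d = *-monoʳ-≤ 3 (m≤n+m (moment-small d) (moment-large (d ∸ 1)))

budget-positive : ∀ d → 0 < budget d
budget-positive d =
  ≤-trans (moment-positive 1 (suc d) 1 d _ z<s) (≤-trans (m≤n*m (moment-small d) 3) (budget-small d))

-- A vertex exists, so n > 0; this rules out d = 0 in claims (i),(ii).
inhabited : ∀ {n} → Fin n → 0 < n
inhabited zero    = z<s
inhabited (suc _) = z<s

path≤1 : ∀ {n} (T : RootedTree n) u v → path T u v ≤ 1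
path≤1 T u v = indicator≤1 _
  where
  indicator≤1 : ∀ b → (if b then 1 else 0) ≤ 1
  indicator≤1 true  = ≤-refl
  indicator≤1 false = z≤n

module _ {n : ℕ} (T : RootedTree n) (s : Fin n) where

  private
    inside : Fin n → ℕ
    inside = path T s
    outside : Fin n → ℕ
    outside v = 1 ∸ path T s v
    inside+outside : ∀ v → inside v + outside v ≡ 1
    inside+outside v = m+[n∸m]≡n (path≤1 T s v)
    outside+inside : ∀ v → outside v + inside v ≡ 1
    outside+inside v = m∸n+n≡m (path≤1 T s v)
    a = count T s (allFin n)
    a′ = sum (map outside (allFin n))
    a+a′≡n : a + a′ ≡ n
    a+a′≡n = mass inside outside inside+outside
    misses : ∀ {K} → Vec (Fin n) K → ℕ
    misses X = sum (map outside (toList X))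
    complement-tail : ∀ {K} (X : Vec (Fin n) K) u x →
      count T s (toList X) * u + x ≤ u * K → x ≤ u * misses X
    complement-tail X u x = complement-count (count T s (toList X)) (misses X) u x
      (sample-split inside outside inside+outside X)

  -- (i) a large subtree is seen at least K/(d+1) times: the complement has
  -- density ≤ (d-1)/d and a failure needs d·K ≤ (d+1)·misses.
  case-i : ∀ d → n ≤ a * d →
    HighProb n (budget d * ⌈log₂ n ⌉)
      (λ X → does (budget d * ⌈log₂ n ⌉ ≤? count T s (toList X) * suc d))
  case-i zero n≤0 = ⊥-elim (<⇒≱ (inhabited s) (≤-trans n≤0 (≤-reflexive (*-zeroʳ a))))
  case-i d@(suc r) n≤ad = tail-bound outside inside outside+inside r 1 d 1 (budget d) _
    (*-monoˡ-< 1 (n<1+n r)) (budget-large r)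
    (density-large a a′ r (subst (_≤ a * d) (sym a+a′≡n) n≤ad))
    λ X fails → ≤-trans
      (complement-tail X (suc d) (d * K)
        (+-monoˡ-≤ (d * K) (<⇒≤ (≰⇒> (rejected (K ≤? count T s (toList X) * suc d) fails)))))
      (≤-reflexive (cong (_* misses X) (+-comm 1 d)))
    where K = budget d * ⌈log₂ n ⌉

  case-ii : ∀ d → a * d + n ≤ n * d →
    HighProb n (budget d * ⌈log₂ n ⌉)
      (λ X → does (count T s (toList X) * suc d ≤? budget d * ⌈log₂ n ⌉ * d))
  case-ii zero h =
    ⊥-elim (<⇒≱ (inhabited s) (≤-trans (m≤n+m n (a * 0)) (≤-trans h (≤-reflexive (*-zeroʳ n)))))
  case-ii d@(suc r) h = tail-bound inside outside inside+outside r 1 d 1 (budget d) _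
    (*-monoˡ-< 1 (n<1+n r)) (budget-large r)
    (density-not-large a a′ r (subst (λ m → a * d + m ≤ m * d) (sym a+a′≡n) h))
    λ X fails → begin
      d * K                 ≡⟨ *-comm d K ⟩
      K * d                 ≤⟨ <⇒≤ (≰⇒> (rejected (count T s (toList X) * suc d ≤? K * d) fails)) ⟩
      count T s (toList X) * suc d ≡⟨ *-comm (count T s (toList X)) (suc d) ⟩
      suc d * count T s (toList X) ≡⟨ cong (_* count T s (toList X)) (+-comm 1 d) ⟩
      (d + 1) * count T s (toList X) ∎
    where
    open ≤-Reasoning
    K = budget d * ⌈log₂ n ⌉

  case-iii : ∀ d → a * suc (suc d) < n →
    HighProb n (budget d * ⌈log₂ n ⌉)
      (λ X → does (count T s (toList X) * suc d <? budget d * ⌈log₂ n ⌉))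
  case-iii d h = tail-bound inside outside inside+outside 1 (suc d) 1 d (budget d) _
    (*-monoʳ-< 1 (n<1+n d)) (budget-small d)
    (density-small a a′ d (subst (a * suc (suc d) <_) (sym a+a′≡n) h))
    λ X fails → begin
      1 * K                          ≡⟨ *-identityˡ K ⟩
      K                              ≤⟨ ≮⇒≥ (rejected (count T s (toList X) * suc d <? K) fails) ⟩
      count T s (toList X) * suc d   ≡⟨ *-comm (count T s (toList X)) (suc d) ⟩
      suc d * count T s (toList X)   ∎
    where
    open ≤-Reasoning
    K = budget d * ⌈log₂ n ⌉

  case-iv : ∀ d → n * suc d < a * suc (suc d) →
    HighProb n (budget d * ⌈log₂ n ⌉)
      (λ X → does (budget d * ⌈log₂ n ⌉ * d <? count T s (toList X) * suc d))
  case-iv d h = tail-bound outside inside outside+inside 1 (suc d) 1 d (budget d) _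
    (*-monoʳ-< 1 (n<1+n d)) (budget-small d)
    (density-not-small a a′ d (subst (λ m → m * suc d < a * suc (suc d)) (sym a+a′≡n) h))
    λ X fails → ≤-trans (≤-reflexive (*-identityˡ K))
      (complement-tail X (suc d) K
        (≤-trans (+-monoˡ-≤ K (≮⇒≥ (rejected (K * d <? count T s (toList X) * suc d) fails)))
                 (≤-reflexive (trans (+-comm (K * d) K) (cong (K +_) (*-comm K d))))))
    where K = budget d * ⌈log₂ n ⌉

lemma20 : (d : ℕ) → Σ ℕ λ C₂ → 0 < C₂ ×
    ((n : ℕ) (T : RootedTree n) → degree T ≡ d → (s : Fin n) →
      (n ≤ count T s (allFin n) * d →
        HighProb n (C₂ * ⌈log₂ n ⌉)
          (λ X → does (C₂ * ⌈log₂ n ⌉ ≤? count T s (toList X) * suc d)))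
      × (count T s (allFin n) * d + n ≤ n * d →
        HighProb n (C₂ * ⌈log₂ n ⌉)
          (λ X → does (count T s (toList X) * suc d ≤? C₂ * ⌈log₂ n ⌉ * d)))
      × (count T s (allFin n) * suc (suc d) < n →
        HighProb n (C₂ * ⌈log₂ n ⌉)
          (λ X → does (count T s (toList X) * suc d <? C₂ * ⌈log₂ n ⌉)))
      × (n * suc d < count T s (allFin n) * suc (suc d) →
        HighProb n (C₂ * ⌈log₂ n ⌉)
          (λ X → does (C₂ * ⌈log₂ n ⌉ * d <? count T s (toList X) * suc d))))
lemma20 d = budget d , budget-positive d ,
  λ n T _ s → case-i T s d , case-ii T s d , case-iii T s d , case-iv T s d
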